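{- Let $G$ be a finite simple graph with exactly two holes $C_1$ and $C_2$. For $t\in\{1,2\}$ let $X_t$ be the set of vertices of $G$ adjacent to every vertex of $C_t$. If $|E(C_1)\cap E(C_2)| \ge 2$, then $X_1 = X_2$.
   Context: A hole of a graph is an induced subgraph that is a cycle of length at least $4$. -}

module Defs where

open import Data.Nat using (ℕ; suc; _+_; _%_)
open import Data.Fin using (Fin; toℕ)
open import Data.Fin.Subset using (Subset; _∈_)
open import Data.Bool using (Bool; true; false)
open import Data.Product using (Σ; ∃; _×_; _,_)
open import Data.Sum using (_⊎_)
open import Function.Bundles using (_⇔_)
open import Function.Definitions using (Injective)
open import Relation.Binary.PropositionalEquality using (_≡_; _≢_)
open import Relation.Nullary using (¬_)

record Graph (n : ℕ) : Set where
  field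
    adj    : Fin n → Fin n → Bool
    sym    : ∀ u v → adj u v ≡ adj v u
    irrefl : ∀ v → adj v v ≡ false

open Graph public

Adj : ∀ {n} → Graph n → Fin n → Fin n → Set
Adj G u v = adj G u v ≡ true

CycNbr : (k : ℕ) → ℕ → ℕ → Set
CycNbr k i j = (j ≡ (i + 1) % suc k) ⊎ (i ≡ (j + 1) % suc k)

-- S is (the vertex set of) a hole: the induced subgraph G[S] is a cycle of
-- length at least 4, i.e. S can be listed injectively as v_0,…,v_{L-1}
-- (L = 4 + m) such that v_i,v_j adjacent in G iff i,j are cyclically consecutive.
IsHole : ∀ {n} → Graph n → Subset n → Set
IsHole {n} G S =
  Σ ℕ λ m → Σ (Fin (suc (suc (suc (suc m)))) → Fin n) λ f →
    Injective _≡_ _≡_ f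
    × (∀ v → (v ∈ S) ⇔ (∃ λ i → f i ≡ v))
    × (∀ i j → Adj G (f i) (f j) ⇔ CycNbr (suc (suc (suc m))) (toℕ i) (toℕ j))

EdgeIn : ∀ {n} → Graph n → Subset n → Fin n → Fin n → Set
EdgeIn G S u v = Adj G u v × u ∈ S × v ∈ S

SamePair : ∀ {n} → Fin n → Fin n → Fin n → Fin n → Set
SamePair u v u' v' = (u ≡ u' × v ≡ v') ⊎ (u ≡ v' × v ≡ u')

TwoCommonEdges : ∀ {n} → Graph n → Subset n → Subset n → Set
TwoCommonEdges {n} G S T =
  Σ (Fin n) λ u₁ → Σ (Fin n) λ v₁ → Σ (Fin n) λ u₂ → Σ (Fin n) λ v₂ →
    EdgeIn G S u₁ v₁ × EdgeIn G T u₁ v₁ ×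
    EdgeIn G S u₂ v₂ × EdgeIn G T u₂ v₂ ×
    ¬ SamePair u₁ v₁ u₂ v₂

ExactlyTwoHoles : ∀ {n} → Graph n → Subset n → Subset n → Set
ExactlyTwoHoles {n} G S₁ S₂ =
  IsHole G S₁ × IsHole G S₂ × S₁ ≢ S₂ ×
  (∀ (S : Subset n) → IsHole G S → (S ≡ S₁) ⊎ (S ≡ S₂))

CompleteTo : ∀ {n} → Graph n → Subset n → Fin n → Set
CompleteTo G S x = ∀ u → u ∈ S → Adj G x u

module Submission where

-- Let x be complete to C₁.  Two distinct common edges of C₁ and C₂ span three
-- distinct common vertices, so x has three neighbours on the hole C₂; as a vertex of
-- a hole has only two neighbours on it, x ∉ C₂, and clearly x ∉ C₁.  Suppose x misses
-- a vertex of C₂.  Walking around C₂, take a neighbour v_i of x followed by a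
-- non-neighbour, and the next neighbour v_b of x after it.  Because x has a third
-- neighbour on C₂, the arc v_i … v_b does not wrap around C₂, so it is an induced path
-- with at least three vertices, and x closes it into a hole different from C₁ and C₂.

open import Defs renaming (sym to adj-sym; irrefl to adj-irrefl)
open import Data.Bool as Bool using (true)
open import Data.Bool.Properties using (T-≡)
open import Data.Fin as Fin using (Fin; zero; suc; toℕ; fromℕ<)
open import Data.Fin.Properties using (toℕ-injective; toℕ-fromℕ<; toℕ<n; any?)
open import Data.Fin.Subset using (Subset; _∈_; _∉_)
open import Data.Nat as ℕ using (ℕ; zero; suc; _+_; _*_; _∸_; _%_; _/_; _≤_; _<_; _≮_; _≤?_; z≤n; s≤s; s≤s⁻¹; z<s; NonZero)
open import Data.Nat.Properties
open import Data.Nat.DivMod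
open import Data.Product using (∃; _×_; _,_; proj₁; proj₂)
open import Data.Sum using (_⊎_; inj₁; inj₂; [_,_]; [_,_]′; swap)
open import Data.Sum.Function.Propositional using (_⊎-⇔_)
open import Data.Vec using (tabulate)
open import Data.Vec.Properties using (lookup∘tabulate; []=⇒lookup; lookup⇒[]=)
open import Function using (_∘_)
open import Function.Construct.Composition using (_⇔-∘_)
open import Function.Construct.Symmetry using (⇔-sym)
open import Function.Bundles using (_⇔_; mk⇔; Equivalence)
open import Function.Definitions using (Injective)
open import Relation.Binary.Definitions using (tri<; tri≈; tri>)
open import Relation.Binary.PropositionalEquality using (_≡_; _≢_; refl; sym; trans; cong; subst; subst₂; ≢-sym; module ≡-Reasoning)
open import Relation.Nullary using (¬_; Dec; yes; no; contradiction)
open import Relation.Nullary.Decidable using (isYes; toWitness; fromWitness; decidable-stable)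
open import Relation.Unary using (Decidable)

open Equivalence using (to; from)

%-distinct-within-period : ∀ k {a c} → a < c → c < a + suc k → a % suc k ≢ c % suc k
%-distinct-within-period k {a} {c} a<c c<a+L a%≡c% = <⇒≱ c<a+L a+L≤c
  where
  L r : ℕ
  L = suc k
  r = c % L
  a≡ : a ≡ r + a / L * L
  a≡ = trans (m≡m%n+[m/n]*n a L) (cong (_+ a / L * L) a%≡c%)
  c≡ : c ≡ r + c / L * L
  c≡ = m≡m%n+[m/n]*n c L
  a/L<c/L : a / L < c / L
  a/L<c/L = ≰⇒> λ c/L≤a/L →
    <⇒≱ a<c (subst₂ _≤_ (sym c≡) (sym a≡) (+-monoʳ-≤ r (*-monoˡ-≤ L c/L≤a/L)))
  a+L≤c : a + L ≤ c
  a+L≤c = begin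
    a + L                ≡⟨ cong (_+ L) a≡ ⟩
    r + a / L * L + L    ≡⟨ +-assoc r _ L ⟩
    r + (a / L * L + L)  ≡⟨ cong (r +_) (+-comm _ L) ⟩
    r + suc (a / L) * L  ≤⟨ +-monoʳ-≤ r (*-monoˡ-≤ L a/L<c/L) ⟩
    r + c / L * L        ≡⟨ c≡ ⟨
    c                    ∎
    where open ≤-Reasoning

%-injective-on-window : ∀ k {s a b} → s ≤ a → a < s + suc k → s ≤ b → b < s + suc k →
                        a % suc k ≡ b % suc k → a ≡ b
%-injective-on-window k {s} {a} {b} s≤a a<s+L s≤b b<s+L eq with <-cmp a b
... | tri≈ _ a≡b _ = a≡b
... | tri< a<b _ _ = contradiction eq (%-distinct-within-period k a<b (<-≤-trans b<s+L (+-monoˡ-≤ _ s≤a)))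
... | tri> _ _ b<a = contradiction (sym eq) (%-distinct-within-period k b<a (<-≤-trans a<s+L (+-monoˡ-≤ _ s≤b)))

[1+m%n]%n≡[1+m]%n : ∀ m n .{{_ : NonZero n}} → suc (m % n) % n ≡ suc m % n
[1+m%n]%n≡[1+m]%n m n = begin
  (1 + m % n) % n          ≡⟨ %-distribˡ-+ 1 (m % n) n ⟩
  (1 % n + m % n % n) % n  ≡⟨ cong (λ r → (1 % n + r) % n) (m%n%n≡m%n m n) ⟩
  (1 % n + m % n) % n      ≡⟨ %-distribˡ-+ 1 m n ⟨
  (1 + m) % n              ∎
  where open ≡-Reasoning

%-suc-injective : ∀ k a b → suc a % suc k ≡ suc b % suc k → a % suc k ≡ b % suc k
%-suc-injective k a b eq = trans (shift a) (trans (cong (λ r → (r + k % L) % L) eq) (sym (shift b)))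
  where
  L : ℕ
  L = suc k
  shift : ∀ x → x % L ≡ (suc x % L + k % L) % L
  shift x = begin
    x % L                  ≡⟨ [m+n]%n≡m%n x L ⟨
    (x + L) % L            ≡⟨ cong (_% L) (+-suc x k) ⟩
    (suc x + k) % L        ≡⟨ %-distribˡ-+ (suc x) k L ⟩
    (suc x % L + k % L) % L ∎
    where open ≡-Reasoning

[m+1]%n≡1+m : ∀ {k a} → a < k → (a + 1) % suc k ≡ suc a
[m+1]%n≡1+m {k} {a} a<k = trans (cong (_% suc k) (+-comm a 1)) (m≤n⇒m%n≡m a<k)

[n+1]%[1+n]≡0 : ∀ k → (k + 1) % suc k ≡ 0
[n+1]%[1+n]≡0 k = trans (cong (_% suc k) (+-comm k 1)) (n%n≡0 (suc k))

≡[m+1]%n⇔≡1+m : ∀ {k a b} → a ≤ k → 0 < b → b ≤ k → b ≡ (a + 1) % suc k ⇔ b ≡ suc a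
≡[m+1]%n⇔≡1+m {k} {a} {b} a≤k 0<b b≤k with m≤n⇒m<n∨m≡n a≤k
... | inj₁ a<k = mk⇔ (λ e → trans e ([m+1]%n≡1+m a<k)) (λ e → trans e (sym ([m+1]%n≡1+m a<k)))
... | inj₂ refl = mk⇔ (λ e → contradiction (trans e ([n+1]%[1+n]≡0 k)) (>⇒≢ 0<b))
                      (λ e → contradiction (subst (_≤ k) e b≤k) (n≮n k))

0≡[m+1]%n⇔m≡n : ∀ {k a} → a ≤ k → 0 ≡ (a + 1) % suc k ⇔ a ≡ k
0≡[m+1]%n⇔m≡n {k} {a} a≤k with m≤n⇒m<n∨m≡n a≤k
... | inj₁ a<k = mk⇔ (λ e → contradiction (trans e ([m+1]%n≡1+m a<k)) (λ ()))
                     (λ e → contradiction a<k (subst (_≮ k) (sym e) (n≮n k)))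
... | inj₂ refl = mk⇔ (λ _ → refl) (λ _ → sym ([n+1]%[1+n]≡0 k))

suc≡suc⇔≡ : ∀ {m n} → suc m ≡ suc n ⇔ m ≡ n
suc≡suc⇔≡ = mk⇔ suc-injective (cong suc)

CycNbr-%⇔ : ∀ k a c → CycNbr k (a % suc k) (c % suc k) ⇔
            (c % suc k ≡ suc a % suc k ⊎ a % suc k ≡ suc c % suc k)
CycNbr-%⇔ k a c = ≡-rewriteʳ (step a) ⊎-⇔ ≡-rewriteʳ (step c)
  where
  L : ℕ
  L = suc k
  step : ∀ x → (x % L + 1) % L ≡ suc x % L
  step x = trans (cong (_% L) (+-comm (x % L) 1)) ([1+m%n]%n≡[1+m]%n x L)
  ≡-rewriteʳ : ∀ {y z w : ℕ} → z ≡ w → y ≡ z ⇔ y ≡ w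
  ≡-rewriteʳ z≡w = mk⇔ (λ e → trans e z≡w) (λ e → trans e (sym z≡w))

CycNbr-0-suc⇔ : ∀ {ℓ a} → a ≤ ℓ → CycNbr (suc ℓ) 0 (suc a) ⇔ (a ≡ 0 ⊎ a ≡ ℓ)
CycNbr-0-suc⇔ a≤ℓ =
  (suc≡suc⇔≡ ⇔-∘ ≡[m+1]%n⇔≡1+m z≤n z<s (s≤s a≤ℓ)) ⊎-⇔ (suc≡suc⇔≡ ⇔-∘ 0≡[m+1]%n⇔m≡n (s≤s a≤ℓ))

CycNbr-suc-suc⇔ : ∀ {k a b} → suc a ≤ k → suc b ≤ k → CycNbr k (suc a) (suc b) ⇔ (b ≡ suc a ⊎ a ≡ suc b)
CycNbr-suc-suc⇔ a<k b<k =
  (suc≡suc⇔≡ ⇔-∘ ≡[m+1]%n⇔≡1+m a<k z<s b<k) ⊎-⇔ (suc≡suc⇔≡ ⇔-∘ ≡[m+1]%n⇔≡1+m b<k z<s a<k)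

image : ∀ {n N} → (Fin N → Fin n) → Subset n
image g = tabulate λ v → isYes (any? λ i → g i Fin.≟ v)

∈-image⇔ : ∀ {n N} (g : Fin N → Fin n) v → v ∈ image g ⇔ ∃ λ i → g i ≡ v
∈-image⇔ g v = mk⇔
  (λ v∈ → toWitness (from T-≡ (trans (sym (lookup∘tabulate _ v)) ([]=⇒lookup v∈))))
  (λ hit → lookup⇒[]= v (image g) (trans (lookup∘tabulate _ v) (to T-≡ (fromWitness hit))))

boundary : ∀ {P : ℕ → Set} → Decidable P → ∀ {a} d → P a → ¬ P (d + a) → ∃ λ k → P k × ¬ P (suc k)
boundary P? zero pa ¬pa = contradiction pa ¬pa
boundary P? {a} (suc d) pa ¬pd with P? (d + a)
... | yes pd′ = d + a , pd′ , ¬pd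
... | no ¬pd′ = boundary P? d pa ¬pd′

next-hit : ∀ {P : ℕ → Set} → Decidable P → ∀ {i} d → P (suc d + i) →
           ∃ λ b → i < b × P b × (∀ j → i < j → j < b → ¬ P j)
next-hit P? {i} zero p = suc i , ≤-refl , p , λ j i<j j<1+i → contradiction i<j (<⇒≱ j<1+i)
next-hit {P} P? {i} (suc d) p with P? (suc i)
... | yes p₁ = suc i , ≤-refl , p₁ , λ j i<j j<1+i → contradiction i<j (<⇒≱ j<1+i)
... | no ¬p₁ with next-hit P? {suc i} d (subst P (cong suc (sym (+-suc d i))) p)
...   | b , 1+i<b , pb , gap = b , <-trans (n<1+n i) 1+i<b , pb , gap′
  where
  gap′ : ∀ j → i < j → j < b → ¬ P j
  gap′ j i<j j<b with m≤n⇒m<n∨m≡n i<j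
  ... | inj₁ 1+i<j = gap j 1+i<j j<b
  ... | inj₂ refl = ¬p₁

Distinct₃ : {A : Set} → A → A → A → Set
Distinct₃ a b c = a ≢ b × a ≢ c × b ≢ c

¬Distinct₃-within-pair : ∀ {A : Set} {u v a b c : A} →
  a ≡ u ⊎ a ≡ v → b ≡ u ⊎ b ≡ v → c ≡ u ⊎ c ≡ v → ¬ Distinct₃ a b c
¬Distinct₃-within-pair (inj₁ refl) (inj₁ refl) _           (a≢b , _)       = a≢b refl
¬Distinct₃-within-pair (inj₂ refl) (inj₂ refl) _           (a≢b , _)       = a≢b refl
¬Distinct₃-within-pair (inj₁ refl) (inj₂ refl) (inj₁ refl) (_ , a≢c , _)   = a≢c refl
¬Distinct₃-within-pair (inj₁ refl) (inj₂ refl) (inj₂ refl) (_ , _ , b≢c)   = b≢c refl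
¬Distinct₃-within-pair (inj₂ refl) (inj₁ refl) (inj₁ refl) (_ , _ , b≢c)   = b≢c refl
¬Distinct₃-within-pair (inj₂ refl) (inj₁ refl) (inj₂ refl) (_ , a≢c , _)   = a≢c refl

module _ {n} (G : Graph n) where

  Adj? : ∀ u v → Dec (Adj G u v)
  Adj? u v = adj G u v Bool.≟ true

  Adj-sym : ∀ {u v} → Adj G u v → Adj G v u
  Adj-sym {u} {v} = trans (adj-sym G v u)

  Adj-sym⇔ : ∀ {u v} → Adj G u v ⇔ Adj G v u
  Adj-sym⇔ = mk⇔ Adj-sym Adj-sym

  Adj-irrefl : ∀ {u} → ¬ Adj G u u
  Adj-irrefl {u} e with trans (sym (adj-irrefl G u)) e
  ... | ()

  Adj⇒≢ : ∀ {u v} → Adj G u v → u ≢ v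
  Adj⇒≢ e refl = Adj-irrefl e

  distinct-edges⇒third-vertex : ∀ {u₁ v₁ u₂ v₂} → Adj G u₁ v₁ → Adj G u₂ v₂ → ¬ SamePair u₁ v₁ u₂ v₂ →
                                ∃ λ w → (w ≡ u₂ ⊎ w ≡ v₂) × Distinct₃ u₁ v₁ w
  distinct-edges⇒third-vertex {u₁} {v₁} {u₂} {v₂} e₁ e₂ ¬same
    with u₂ Fin.≟ u₁ | u₂ Fin.≟ v₁ | v₂ Fin.≟ u₁ | v₂ Fin.≟ v₁
  ... | no u₂≢u₁ | no u₂≢v₁ | _ | _ = u₂ , inj₁ refl , Adj⇒≢ e₁ , ≢-sym u₂≢u₁ , ≢-sym u₂≢v₁
  ... | _ | _ | no v₂≢u₁ | no v₂≢v₁ = v₂ , inj₂ refl , Adj⇒≢ e₁ , ≢-sym v₂≢u₁ , ≢-sym v₂≢v₁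
  ... | yes refl | _ | yes refl | _ = contradiction e₂ Adj-irrefl
  ... | _ | yes refl | _ | yes refl = contradiction e₂ Adj-irrefl
  ... | yes refl | _ | no _ | yes refl = contradiction (inj₁ (refl , refl)) ¬same
  ... | no _ | yes refl | yes refl | _ = contradiction (inj₂ (refl , refl)) ¬same

IsInducedPath : ∀ {n N} → Graph n → (Fin N → Fin n) → Set
IsInducedPath G p = Injective _≡_ _≡_ p ×
                    (∀ k l → Adj G (p k) (p l) ⇔ (toℕ l ≡ suc (toℕ k) ⊎ toℕ k ≡ suc (toℕ l)))

path+apex⇒hole : ∀ {n} (G : Graph n) {ℓ} {p : Fin (suc ℓ) → Fin n} {x} → 2 ≤ ℓ → IsInducedPath G p →
                 (∀ k → x ≢ p k) → (∀ k → Adj G x (p k) ⇔ (toℕ k ≡ 0 ⊎ toℕ k ≡ ℓ)) →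
                 ∃ λ S → IsHole G S × x ∈ S
path+apex⇒hole {n} G {suc (suc m)} {p} {x} (s≤s (s≤s z≤n)) (p-injective , p-adj) x∉p x-adj =
  image cycle , (m , cycle , cycle-injective , ∈-image⇔ cycle , cycle-adj) , from (∈-image⇔ cycle x) (zero , refl)
  where
  cycle : Fin (4 + m) → Fin n
  cycle zero    = x
  cycle (suc k) = p k

  cycle-injective : Injective _≡_ _≡_ cycle
  cycle-injective {zero}  {zero}  _ = refl
  cycle-injective {zero}  {suc l} e = contradiction e (x∉p l)
  cycle-injective {suc k} {zero}  e = contradiction (sym e) (x∉p k)
  cycle-injective {suc k} {suc l} e = cong suc (p-injective e)

  CycNbr-swap : ∀ {i j} → CycNbr (3 + m) i j ⇔ CycNbr (3 + m) j i
  CycNbr-swap = mk⇔ swap swap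

  cycle-adj : ∀ i j → Adj G (cycle i) (cycle j) ⇔ CycNbr (3 + m) (toℕ i) (toℕ j)
  cycle-adj zero    zero    = mk⇔ (λ e → contradiction e (Adj-irrefl G)) λ { (inj₁ ()) ; (inj₂ ()) }
  cycle-adj zero    (suc l) = ⇔-sym (CycNbr-0-suc⇔ (s≤s⁻¹ (toℕ<n l))) ⇔-∘ x-adj l
  cycle-adj (suc k) zero    =
    CycNbr-swap ⇔-∘ (⇔-sym (CycNbr-0-suc⇔ (s≤s⁻¹ (toℕ<n k))) ⇔-∘ (x-adj k ⇔-∘ Adj-sym⇔ G))
  cycle-adj (suc k) (suc l) = ⇔-sym (CycNbr-suc-suc⇔ (toℕ<n k) (toℕ<n l)) ⇔-∘ p-adj k l

module HoleWalk {n} (G : Graph n) {D : Subset n} (hole : IsHole G D) where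

  m : ℕ
  m = proj₁ hole

  L : ℕ
  L = 4 + m

  vertex : Fin L → Fin n
  vertex = proj₁ (proj₂ hole)

  vertex-injective : Injective _≡_ _≡_ vertex
  vertex-injective = proj₁ (proj₂ (proj₂ hole))

  ∈⇔vertex : ∀ v → v ∈ D ⇔ ∃ λ i → vertex i ≡ v
  ∈⇔vertex = proj₁ (proj₂ (proj₂ (proj₂ hole)))

  Adj-vertex⇔ : ∀ i j → Adj G (vertex i) (vertex j) ⇔ CycNbr (3 + m) (toℕ i) (toℕ j)
  Adj-vertex⇔ = proj₂ (proj₂ (proj₂ (proj₂ hole)))

  position : ℕ → Fin L
  position k = fromℕ< (m%n<n k L)

  -- Positions are natural numbers read modulo L, so that arcs of the hole are
  -- intervals of ℕ and never wrap around.
  walk : ℕ → Fin n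
  walk = vertex ∘ position

  toℕ-position : ∀ k → toℕ (position k) ≡ k % L
  toℕ-position k = toℕ-fromℕ< (m%n<n k L)

  walk-cong : ∀ a b → a % L ≡ b % L → walk a ≡ walk b
  walk-cong a b e = cong vertex (toℕ-injective (trans (toℕ-position a) (trans e (sym (toℕ-position b)))))

  walk-periodic : ∀ k → walk (k + L) ≡ walk k
  walk-periodic k = walk-cong (k + L) k ([m+n]%n≡m%n k L)

  walk-injective-on-window : ∀ {s a b} → s ≤ a → a < s + L → s ≤ b → b < s + L → walk a ≡ walk b → a ≡ b
  walk-injective-on-window {s} {a} {b} s≤a a<s+L s≤b b<s+L e =
    %-injective-on-window (3 + m) s≤a a<s+L s≤b b<s+L
      (trans (sym (toℕ-position a)) (trans (cong toℕ (vertex-injective e)) (toℕ-position b)))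

  walk∈ : ∀ k → walk k ∈ D
  walk∈ k = from (∈⇔vertex (walk k)) (position k , refl)

  ∈⇒walk : ∀ {v} → v ∈ D → ∃ λ k → k < L × walk k ≡ v
  ∈⇒walk {v} v∈ with to (∈⇔vertex v) v∈
  ... | i , vertex-i≡v = toℕ i , toℕ<n i , trans (cong vertex position-i≡i) vertex-i≡v
    where
    position-i≡i : position (toℕ i) ≡ i
    position-i≡i = toℕ-injective (trans (toℕ-position (toℕ i)) (m<n⇒m%n≡m (toℕ<n i)))

  ∈⇒walk-in-window : ∀ {s v} → s < L → v ∈ D → ∃ λ r → s ≤ r × r < s + L × walk r ≡ v
  ∈⇒walk-in-window {s} s<L v∈ with ∈⇒walk v∈
  ... | k , k<L , wk≡v with s ≤? k
  ...   | yes s≤k = k , s≤k , <-≤-trans k<L (m≤n+m L s) , wk≡v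
  ...   | no s≰k = k + L , ≤-trans (<⇒≤ s<L) (m≤n+m L k) , +-monoˡ-< L (≰⇒> s≰k) ,
                   trans (walk-periodic k) wk≡v

  Adj-walk⇔ : ∀ a c → Adj G (walk a) (walk c) ⇔ (c % L ≡ suc a % L ⊎ a % L ≡ suc c % L)
  Adj-walk⇔ a c = CycNbr-%⇔ (3 + m) a c ⇔-∘
    subst₂ (λ i j → Adj G (walk a) (walk c) ⇔ CycNbr (3 + m) i j) (toℕ-position a) (toℕ-position c)
      (Adj-vertex⇔ (position a) (position c))

  Adj-walk-suc : ∀ k → Adj G (walk k) (walk (suc k))
  Adj-walk-suc k = from (Adj-walk⇔ k (suc k)) (inj₁ refl)

  Adj-walk-forward : ∀ {a c} → a < c → suc c < a + L → Adj G (walk a) (walk c) → c ≡ suc a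
  Adj-walk-forward {a} {c} a<c 1+c<a+L e with to (Adj-walk⇔ a c) e
  ... | inj₁ c≡1+a = sym (%-injective-on-window (3 + m) ≤-refl (m<m+n (suc a) z<s) a<c
                          (<-trans (n<1+n c) (<-trans 1+c<a+L (n<1+n (a + L)))) (sym c≡1+a))
  ... | inj₂ a≡1+c = contradiction
          (%-injective-on-window (3 + m) (<⇒≤ 1+c<a+L) (+-monoˡ-< L (<-trans a<c (n<1+n c)))
             ≤-refl (m<m+n (suc c) z<s) (trans ([m+n]%n≡m%n a L) a≡1+c))
          (≢-sym (<⇒≢ 1+c<a+L))

  walk-neighbour : ∀ e {w} → w ∈ D → Adj G (walk e) w → w ≡ walk (suc e) ⊎ w ≡ walk (e + (3 + m))
  walk-neighbour e w∈ e~w with ∈⇒walk w∈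
  ... | a , _ , wa≡w with to (Adj-walk⇔ e a) (subst (Adj G (walk e)) (sym wa≡w) e~w)
  ...   | inj₁ a≡1+e = inj₁ (trans (sym wa≡w) (walk-cong a (suc e) a≡1+e))
  ...   | inj₂ e≡1+a = inj₂ (trans (sym wa≡w) (walk-cong a (e + (3 + m)) (%-suc-injective (3 + m) a (e + (3 + m)) 1+a≡e+L)))
    where
    1+a≡e+L : suc a % L ≡ suc (e + (3 + m)) % L
    1+a≡e+L = begin
      suc a % L              ≡⟨ e≡1+a ⟨
      e % L                  ≡⟨ [m+n]%n≡m%n e L ⟨
      (e + L) % L            ≡⟨ cong (_% L) (+-suc e (3 + m)) ⟩
      suc (e + (3 + m)) % L  ∎
      where open ≡-Reasoning

  segment : ℕ → ∀ {N} → Fin N → Fin n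
  segment i k = walk (i + toℕ k)

  segment-induced : ∀ i {N} → N < L → IsInducedPath G (segment i {N})
  segment-induced i {N} N<L = injective , adjacent
    where
    in-window : ∀ k → i + toℕ k < i + L
    in-window k = +-monoʳ-< i (<-trans (toℕ<n k) N<L)

    injective : Injective _≡_ _≡_ (segment i)
    injective {k} {l} e = toℕ-injective (+-cancelˡ-≡ i _ _
      (walk-injective-on-window (m≤m+n i _) (in-window k) (m≤m+n i _) (in-window l) e))

    close : ∀ k l → suc (i + toℕ l) < i + toℕ k + L
    close k l = begin-strict
      suc (i + toℕ l)  ≡⟨ +-suc i (toℕ l) ⟨
      i + suc (toℕ l)  ≤⟨ +-monoʳ-≤ i (toℕ<n l) ⟩
      i + N            <⟨ +-monoʳ-< i N<L ⟩
      i + L            ≤⟨ +-monoˡ-≤ L (m≤m+n i (toℕ k)) ⟩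
      i + toℕ k + L    ∎
      where open ≤-Reasoning

    forward : ∀ {k l} → toℕ k < toℕ l → Adj G (segment i k) (segment i l) → toℕ l ≡ suc (toℕ k)
    forward {k} {l} k<l e = +-cancelˡ-≡ i _ _
      (trans (Adj-walk-forward (+-monoʳ-< i k<l) (close k l) e) (sym (+-suc i (toℕ k))))

    backward : ∀ {k l} → toℕ l ≡ suc (toℕ k) → Adj G (segment i k) (segment i l)
    backward {k} {l} l≡1+k = subst (Adj G (segment i k) ∘ walk)
      (trans (sym (+-suc i (toℕ k))) (cong (i +_) (sym l≡1+k))) (Adj-walk-suc (i + toℕ k))

    adjacent : ∀ k l → Adj G (segment i k) (segment i l) ⇔ (toℕ l ≡ suc (toℕ k) ⊎ toℕ k ≡ suc (toℕ l))
    adjacent k l = mk⇔ to′ [ backward , Adj-sym G ∘ backward ]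
      where
      to′ : Adj G (segment i k) (segment i l) → toℕ l ≡ suc (toℕ k) ⊎ toℕ k ≡ suc (toℕ l)
      to′ e with <-cmp (toℕ k) (toℕ l)
      ... | tri< k<l _ _ = inj₁ (forward k<l e)
      ... | tri> _ _ l<k = inj₂ (forward l<k (Adj-sym G e))
      ... | tri≈ _ k≡l _ = contradiction (subst (Adj G (segment i k)) (cong (segment i) (sym (toℕ-injective k≡l))) e) (Adj-irrefl G)

module _ {n} (G : Graph n) {D : Subset n} (hole : IsHole G D) where
  open HoleWalk G hole

  three-neighbours⇒∉hole : ∀ {x w₁ w₂ w₃} → Distinct₃ w₁ w₂ w₃ → w₁ ∈ D → w₂ ∈ D → w₃ ∈ D →
                           Adj G x w₁ → Adj G x w₂ → Adj G x w₃ → x ∉ D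
  three-neighbours⇒∉hole {x} distinct w₁∈ w₂∈ w₃∈ x~w₁ x~w₂ x~w₃ x∈ with ∈⇒walk x∈
  ... | e , _ , walk-e≡x =
    ¬Distinct₃-within-pair (neighbour w₁∈ x~w₁) (neighbour w₂∈ x~w₂) (neighbour w₃∈ x~w₃) distinct
    where
    neighbour : ∀ {w} → w ∈ D → Adj G x w → w ≡ walk (suc e) ⊎ w ≡ walk (e + (3 + m))
    neighbour w∈ x~w = walk-neighbour e w∈ (subst (λ v → Adj G v _) (sym walk-e≡x) x~w)

  module _ (x : Fin n) where

    Seen : ℕ → Set
    Seen k = Adj G x (walk k)

    Seen-cong : ∀ a b → a % L ≡ b % L → Seen a → Seen b
    Seen-cong a b e = subst (Adj G x) (walk-cong a b e)

    seen-unseen-step : ∀ {v u} → v ∈ D → Adj G x v → u ∈ D → ¬ Adj G x u → ∃ λ i → i < L × Seen i × ¬ Seen (suc i)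
    seen-unseen-step v∈ x~v u∈ x≁u with ∈⇒walk v∈ | ∈⇒walk u∈
    ... | t , t<L , wt≡v | j , _ , wj≡u
      with boundary (Adj? G x ∘ walk) (j + L ∸ t) (subst (Adj G x) (sym wt≡v) x~v) unseen
      where
      unseen : ¬ Seen (j + L ∸ t + t)
      unseen seen = x≁u (subst (Adj G x) wj≡u (Seen-cong (j + L ∸ t + t) j (begin
        (j + L ∸ t + t) % L  ≡⟨ cong (_% L) (m∸n+n≡m (≤-trans (<⇒≤ t<L) (m≤n+m L j))) ⟩
        (j + L) % L          ≡⟨ [m+n]%n≡m%n j L ⟩
        j % L                ∎) seen))
        where open ≡-Reasoning
    ... | k , seen-k , unseen-1+k =
      k % L , m%n<n k L , Seen-cong k (k % L) (sym (m%n%n≡m%n k L)) seen-k ,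
      unseen-1+k ∘ Seen-cong (suc (k % L)) (suc k) ([1+m%n]%n≡[1+m]%n k L)

    next-seen : ∀ {i} → Seen i → ¬ Seen (suc i) →
                ∃ λ b → suc i < b × Seen b × (∀ j → i < j → j < b → ¬ Seen j)
    next-seen {i} seen-i unseen-1+i with next-hit (Adj? G x ∘ walk) (3 + m) seen-i+L
      where
      seen-i+L : Seen (L + i)
      seen-i+L = Seen-cong i (L + i) (sym (trans (cong (_% L) (+-comm L i)) ([m+n]%n≡m%n i L))) seen-i
    ... | b , i<b , seen-b , gap =
      b , ≤∧≢⇒< i<b (λ 1+i≡b → unseen-1+i (subst Seen (sym 1+i≡b) seen-b)) , seen-b , gap

    module Arc {i b} (i<L : i < L) (seen-i : Seen i) (1+i<b : suc i < b) (seen-b : Seen b)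
               (gap : ∀ j → i < j → j < b → ¬ Seen j) where

      ℓ : ℕ
      ℓ = b ∸ i

      i+ℓ≡b : i + ℓ ≡ b
      i+ℓ≡b = m+[n∸m]≡n (<⇒≤ (<-trans (n<1+n i) 1+i<b))

      2≤ℓ : 2 ≤ ℓ
      2≤ℓ = subst (_≤ ℓ) (m+n∸n≡m 2 i) (∸-monoˡ-≤ i 1+i<b)

      seen-vertex-position : ∀ {w} → w ∈ D → Adj G x w → ∃ λ r → walk r ≡ w × (r ≡ i ⊎ (b ≤ r × r < i + L))
      seen-vertex-position w∈ x~w with ∈⇒walk-in-window i<L w∈
      ... | r , i≤r , r<i+L , wr≡w with m≤n⇒m<n∨m≡n i≤r
      ...   | inj₂ i≡r = r , wr≡w , inj₁ (sym i≡r)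
      ...   | inj₁ i<r with b ≤? r
      ...     | yes b≤r = r , wr≡w , inj₂ (b≤r , r<i+L)
      ...     | no b≰r = contradiction (subst (Adj G x) (sym wr≡w) x~w) (gap r i<r (≰⇒> b≰r))

      arc-short : ∀ {w₁ w₂ w₃} → Distinct₃ w₁ w₂ w₃ → w₁ ∈ D → w₂ ∈ D → w₃ ∈ D →
                  Adj G x w₁ → Adj G x w₂ → Adj G x w₃ → suc ℓ < L
      -- Otherwise the arc misses at most one vertex of the hole, and every neighbour of
      -- x on the hole is one of its two ends.
      arc-short distinct w₁∈ w₂∈ w₃∈ x~w₁ x~w₂ x~w₃ = ≰⇒> λ L≤1+ℓ →
        ¬Distinct₃-within-pair (end L≤1+ℓ w₁∈ x~w₁) (end L≤1+ℓ w₂∈ x~w₂) (end L≤1+ℓ w₃∈ x~w₃) distinct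
        where
        end : ∀ {w} → L ≤ suc ℓ → w ∈ D → Adj G x w → w ≡ walk i ⊎ w ≡ walk b
        end L≤1+ℓ w∈ x~w with seen-vertex-position w∈ x~w
        ... | r , wr≡w , inj₁ r≡i = inj₁ (trans (sym wr≡w) (cong walk r≡i))
        ... | r , wr≡w , inj₂ (b≤r , r<i+L) = inj₂ (trans (sym wr≡w) (cong walk (≤-antisym r≤b b≤r)))
          where
          r≤b : r ≤ b
          r≤b = s≤s⁻¹ (begin-strict
            r            <⟨ r<i+L ⟩
            i + L        ≤⟨ +-monoʳ-≤ i L≤1+ℓ ⟩
            i + suc ℓ    ≡⟨ +-suc i ℓ ⟩
            suc (i + ℓ)  ≡⟨ cong suc i+ℓ≡b ⟩
            suc b        ∎)
            where open ≤-Reasoning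

      Adj-x-arc⇔ : ∀ (k : Fin (suc ℓ)) → Adj G x (segment i k) ⇔ (toℕ k ≡ 0 ⊎ toℕ k ≡ ℓ)
      Adj-x-arc⇔ k = mk⇔ to′ [ (λ k≡0 → subst Seen (sym (trans (cong (i +_) k≡0) (+-identityʳ i))) seen-i)
                            , (λ k≡ℓ → subst Seen (sym (trans (cong (i +_) k≡ℓ) i+ℓ≡b)) seen-b) ]
        where
        to′ : Adj G x (segment i k) → toℕ k ≡ 0 ⊎ toℕ k ≡ ℓ
        to′ seen with toℕ k ℕ.≟ 0 | toℕ k ℕ.≟ ℓ
        ... | yes k≡0 | _       = inj₁ k≡0
        ... | no _    | yes k≡ℓ = inj₂ k≡ℓ
        ... | no k≢0  | no k≢ℓ  = contradiction seen (gap (i + toℕ k) (m<m+n i (n≢0⇒n>0 k≢0))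
            (subst (i + toℕ k <_) i+ℓ≡b (+-monoʳ-< i (≤∧≢⇒< (s≤s⁻¹ (toℕ<n k)) k≢ℓ))))

      arc+x-is-hole : x ∉ D → suc ℓ < L → ∃ λ S → IsHole G S × x ∈ S
      arc+x-is-hole x∉D 1+ℓ<L = path+apex⇒hole G 2≤ℓ (segment-induced i 1+ℓ<L)
        (λ k x≡ → x∉D (subst (_∈ D) (sym x≡) (walk∈ (i + toℕ k)))) Adj-x-arc⇔

three-neighbours+non-neighbour⇒hole :
  ∀ {n} (G : Graph n) {D : Subset n} → IsHole G D → ∀ {x w₁ w₂ w₃ u} →
  Distinct₃ w₁ w₂ w₃ → w₁ ∈ D → w₂ ∈ D → w₃ ∈ D → Adj G x w₁ → Adj G x w₂ → Adj G x w₃ →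
  u ∈ D → ¬ Adj G x u → ∃ λ S → IsHole G S × x ∈ S
three-neighbours+non-neighbour⇒hole G hole {x} distinct w₁∈ w₂∈ w₃∈ x~w₁ x~w₂ x~w₃ u∈ x≁u =
  let i , i<L , seen-i , unseen-1+i = seen-unseen-step G hole x w₁∈ x~w₁ u∈ x≁u
      b , 1+i<b , seen-b , gap      = next-seen G hole x seen-i unseen-1+i
      open Arc G hole x i<L seen-i 1+i<b seen-b gap
  in arc+x-is-hole (three-neighbours⇒∉hole G hole distinct w₁∈ w₂∈ w₃∈ x~w₁ x~w₂ x~w₃)
                (arc-short distinct w₁∈ w₂∈ w₃∈ x~w₁ x~w₂ x~w₃)

CompleteTo-transfer : ∀ {n} (G : Graph n) {A B : Subset n} → (∀ S → IsHole G S → S ≡ A ⊎ S ≡ B) →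
  IsHole G B → ∀ {w₁ w₂ w₃ x} → Distinct₃ w₁ w₂ w₃ → w₁ ∈ A → w₂ ∈ A → w₃ ∈ A →
  w₁ ∈ B → w₂ ∈ B → w₃ ∈ B → CompleteTo G A x → CompleteTo G B x
CompleteTo-transfer G {A} {B} only holeB {w₁} {w₂} {w₃} {x} distinct a₁ a₂ a₃ b₁ b₂ b₃ complete u u∈B =
  decidable-stable (Adj? G x u) λ x≁u →
    let S , holeS , x∈S = three-neighbours+non-neighbour⇒hole G holeB distinct b₁ b₂ b₃
                            x~w₁ x~w₂ x~w₃ u∈B x≁u
    in [ (λ S≡A → x∉A (subst (x ∈_) S≡A x∈S)) , (λ S≡B → x∉B (subst (x ∈_) S≡B x∈S)) ] (only S holeS)
  where
  x~w₁ : Adj G x w₁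
  x~w₁ = complete _ a₁
  x~w₂ : Adj G x w₂
  x~w₂ = complete _ a₂
  x~w₃ : Adj G x w₃
  x~w₃ = complete _ a₃
  x∉A : x ∉ A
  x∉A x∈A = Adj-irrefl G (complete x x∈A)
  x∉B : x ∉ B
  x∉B = three-neighbours⇒∉hole G holeB distinct b₁ b₂ b₃ x~w₁ x~w₂ x~w₃

lemma11 : ∀ (n : ℕ) (G : Graph n) (C₁ C₂ : Subset n) →
          ExactlyTwoHoles G C₁ C₂ →
          TwoCommonEdges G C₁ C₂ →
          ∀ (x : Fin n) → CompleteTo G C₁ x ⇔ CompleteTo G C₂ x
lemma11 n G C₁ C₂ (hole₁ , hole₂ , _ , only-two)
        (u₁ , v₁ , u₂ , v₂ , (u₁~v₁ , u₁∈C₁ , v₁∈C₁) , (_ , u₁∈C₂ , v₁∈C₂) ,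
                             (u₂~v₂ , u₂∈C₁ , v₂∈C₁) , (_ , u₂∈C₂ , v₂∈C₂) , ¬same) x =
  let w , w≡u₂∨v₂ , distinct = distinct-edges⇒third-vertex G u₁~v₁ u₂~v₂ ¬same
      w∈ : ∀ {S} → u₂ ∈ S → v₂ ∈ S → w ∈ S
      w∈ u₂∈ v₂∈ = [ (λ w≡u₂ → subst (_∈ _) (sym w≡u₂) u₂∈) , (λ w≡v₂ → subst (_∈ _) (sym w≡v₂) v₂∈) ]′ w≡u₂∨v₂
  in mk⇔
    (CompleteTo-transfer G only-two hole₂ distinct
       u₁∈C₁ v₁∈C₁ (w∈ u₂∈C₁ v₂∈C₁) u₁∈C₂ v₁∈C₂ (w∈ u₂∈C₂ v₂∈C₂))
    (CompleteTo-transfer G (λ S h → swap (only-two S h)) hole₁ distinct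
       u₁∈C₂ v₁∈C₂ (w∈ u₂∈C₂ v₂∈C₂) u₁∈C₁ v₁∈C₁ (w∈ u₂∈C₁ v₂∈C₁))
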